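{- Let $k\ge2$. For every $M\in\{1,2,\dots\}\cup\{\infty\}$ and every $N\in\{0,1,2,\dots\}$, the oriented spider-web graph $\vec{SW}_{k,N,M}$ is weakly isomorphic (isomorphic as oriented graphs, ignoring labels) to the oriented Schreier graph $\vec{\mathrm{Sch}}(\mathcal L_k,W_{N,M},X_k)$, where $W_{N,M}=\{g\in W_{N,1}:\exp_{X_k}(g)\equiv0\pmod M\}$.
   Context: Loops and multiple edges allowed. The oriented spider-web graph $\vec{SW}_{k,N,M}$ has vertex set $\{0,\dots,k-1\}^N\times\mathbb Z/M\mathbb Z$ (with $\mathbb Z/\infty\mathbb Z:=\mathbb Z$) and, for each vertex $(x_1\dots x_N,i)$ and each $y\in\{0,\dots,k-1\}$, one edge from $(x_1\dots x_N,i)$ to $(x_2\dots x_Ny,i+1)$. $\mathcal L_k=(\mathbb Z/k\mathbb Z)\wr\mathbb Z$ with $b$ the generator of $\mathbb Z$ (acting by shift), $c$ the generator of the copy of $\mathbb Z/k\mathbb Z$ at coordinate 0, $\bar c_r=c^rb$, $X_k=\{\bar c_0,\dots,\bar c_{k-1}\}$. $\mathcal L_k$ acts on words over $\{0,\dots,k-1\}$ by $\bar c_r.(x_1x_2\dots)=((x_1+r)(x_2+x_1)(x_3+x_2)\dots)$ mod $k$; $W_{N,1}$ is the stabilizer of the word $0^N$ (of length $N$). $\exp_{X_k}\colon\mathcal L_k\to\mathbb Z$ is the homomorphism sending every $\bar c_r$ to $1$ (the total exponent of a word in $X_k^{\pm1}$); "$\equiv0\pmod\infty$" means "$=0$". For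 $H\le G$ and generating set $S$, the oriented Schreier graph $\vec{\mathrm{Sch}}(G,H,S)$ has vertex set the right cosets $Hg$ and an edge labeled $s$ from $Hg$ to $Hgs$ for each $s\in S$. -}

module Defs where

open import Data.Nat using (ℕ; zero; suc; NonZero; _∸_)
import Data.Nat as ℕ
open import Data.Nat.DivMod using (_mod_)
open import Data.Fin using (Fin; toℕ)
open import Data.Integer using (ℤ; +_; -[1+_]; -_) renaming (_+_ to _+ℤ_; _-_ to _-ℤ_)
import Data.Integer as ℤ
open import Data.Integer.Divisibility using () renaming (_∣_ to _∣ℤ_)
open import Data.Bool using (Bool; true; false)
open import Data.List using (List; []; _∷_; _++_)
open import Data.Vec using (Vec; []; _∷_; _∷ʳ_; replicate)
open import Data.Product using (Σ; _×_; _,_; proj₁)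
open import Relation.Binary.PropositionalEquality using (_≡_)

-- Oriented multigraphs (loops and multiple edges allowed), with vertex
-- and edge sets given up to an equivalence relation (needed for the
-- Schreier graph, whose vertices are cosets), and weak isomorphism
-- (isomorphism of oriented graphs, ignoring labels).

record Graph : Set₁ where
  field
    V    : Set
    _≈V_ : V → V → Set
    E    : Set
    _≈E_ : E → E → Set
    src  : E → V
    tgt  : E → V

record WeaklyIso (G H : Graph) : Set where
  private
    module G = Graph G
    module H = Graph H
  field
    fV     : G.V → H.V
    gV     : H.V → G.V
    fV-cong : ∀ {u v} → u G.≈V v → fV u H.≈V fV v
    gV-cong : ∀ {u v} → u H.≈V v → gV u G.≈V gV v
    gfV    : ∀ v → gV (fV v) G.≈V v
    fgV    : ∀ v → fV (gV v) H.≈V v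
    fE     : G.E → H.E
    gE     : H.E → G.E
    fE-cong : ∀ {e e'} → e G.≈E e' → fE e H.≈E fE e'
    gE-cong : ∀ {e e'} → e H.≈E e' → gE e G.≈E gE e'
    gfE    : ∀ e → gE (fE e) G.≈E e
    fgE    : ∀ e → fE (gE e) H.≈E e
    src-comm : ∀ e → H.src (fE e) H.≈V fV (G.src e)
    tgt-comm : ∀ e → H.tgt (fE e) H.≈V fV (G.tgt e)

data Modulus : Set where
  fin : (m : ℕ) → .{{NonZero m}} → Modulus
  ∞   : Modulus

ZMod : Modulus → Set
ZMod (fin m) = Fin m
ZMod ∞       = ℤ

sucMod : (M : Modulus) → ZMod M → ZMod M
sucMod (fin m) i = suc (toℕ i) mod m
sucMod ∞       i = ℤ.suc i

≡0mod : Modulus → ℤ → Set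
≡0mod (fin m) z = (+ m) ∣ℤ z
≡0mod ∞       z = z ≡ + 0

module _ (k : ℕ) {{nz : NonZero k}} where

  _⊕_ : Fin k → Fin k → Fin k
  a ⊕ b = (toℕ a ℕ.+ toℕ b) mod k

  ⊖_ : Fin k → Fin k
  ⊖ a = (k ∸ toℕ a) mod k

  _⊖_ : Fin k → Fin k → Fin k
  a ⊖ b = a ⊕ (⊖ b)

  0k : Fin k
  0k = 0 mod k

  shiftIn : ∀ {N} → Vec (Fin k) N → Fin k → Vec (Fin k) N
  shiftIn []       y = []
  shiftIn (x ∷ xs) y = xs ∷ʳ y

  SW : (N : ℕ) (M : Modulus) → Graph
  SW N M = record
    { V    = Vec (Fin k) N × ZMod M
    ; _≈V_ = _≡_
    ; E    = (Vec (Fin k) N × ZMod M) × Fin k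
    ; _≈E_ = _≡_
    ; src  = proj₁
    ; tgt  = λ { ((x , i) , y) → (shiftIn x y , sucMod M i) }
    }

  record Lamp : Set where
    constructor ⟨_,_⟩
    field
      lamps : ℤ → Fin k
      pos   : ℤ
  open Lamp public

  _·_ : Lamp → Lamp → Lamp
  ⟨ f , n ⟩ · ⟨ g , m ⟩ = ⟨ (λ j → f j ⊕ g (j -ℤ n)) , n +ℤ m ⟩

  lampInv : Lamp → Lamp
  lampInv ⟨ f , n ⟩ = ⟨ (λ j → ⊖ f (j +ℤ n)) , - n ⟩

  lampId : Lamp
  lampId = ⟨ (λ _ → 0k) , + 0 ⟩

  δ₀ : Fin k → ℤ → Fin k
  δ₀ r (+ zero) = r
  δ₀ r _        = 0k

  c̄ : Fin k → Lamp
  c̄ r = ⟨ δ₀ r , + 1 ⟩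

  -- Elements of L_k are written as words in X_k^{±1}
  -- (a letter (r , true) is c̄_r, a letter (r , false) is c̄_r⁻¹).
  Letter : Set
  Letter = Fin k × Bool

  Word : Set
  Word = List Letter

  evalLetter : Letter → Lamp
  evalLetter (r , true)  = c̄ r
  evalLetter (r , false) = lampInv (c̄ r)

  eval : Word → Lamp
  eval []       = lampId
  eval (l ∷ w)  = evalLetter l · eval w

  _=L_ : Word → Word → Set
  g =L h = (∀ j → lamps (eval g) j ≡ lamps (eval h) j) × (pos (eval g) ≡ pos (eval h))

  expX : Word → ℤ
  expX []               = + 0
  expX ((_ , true) ∷ w)  = + 1 +ℤ expX w
  expX ((_ , false) ∷ w) = -[1+ 0 ] +ℤ expX w

  private
    goGen : ∀ {n} → Fin k → Vec (Fin k) n → Vec (Fin k) n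
    goGen p []       = []
    goGen p (x ∷ xs) = (x ⊕ p) ∷ goGen x xs

    goInv : ∀ {n} → Fin k → Vec (Fin k) n → Vec (Fin k) n
    goInv p []       = []
    goInv p (x ∷ xs) = let y = x ⊖ p in y ∷ goInv y xs

  actLetter : ∀ {n} → Letter → Vec (Fin k) n → Vec (Fin k) n
  actLetter (r , true)  v = goGen r v
  actLetter (r , false) v = goInv r v

  act : ∀ {n} → Word → Vec (Fin k) n → Vec (Fin k) n
  act []      v = v
  act (l ∷ w) v = actLetter l (act w v)

  inW : (N : ℕ) (M : Modulus) → Word → Set
  inW N M g = (act g (replicate N 0k) ≡ replicate N 0k) × ≡0mod M (expX g)

  -- right cosets: H g = H g'  iff  g ∈ H g'
  _~[_,_]_ : Word → ℕ → Modulus → Word → Set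
  g ~[ N , M ] g' = Σ Word λ h → inW N M h × (g =L (h ++ g'))

  Schreier : (N : ℕ) (M : Modulus) → Graph
  Schreier N M = record
    { V    = Word
    ; _≈V_ = λ g g' → g ~[ N , M ] g'
    ; E    = Word × Fin k
    ; _≈E_ = λ { (g , s) (g' , s') → (g ~[ N , M ] g') × (s ≡ s') }
    ; src  = proj₁
    ; tgt  = λ { (g , s) → g ++ ((s , true) ∷ []) }
    }

module Submission where

-- Read v ∈ (ℤ/k)ᴺ as a power series mod tᴺ.  Then c̄ᵣ acts by v ↦ (1+t) v + r, so an element
-- ⟨ f , z ⟩ of 𝓛ₖ acts by v ↦ (1+t)ᶻ v + Σⱼ f(j) (1+t)ʲ, and the action of a word depends only on
-- the element of 𝓛ₖ it represents.  Hence the coset W_{N,M} g is determined by the orbit point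
-- g⁻¹·0ᴺ together with exp(g) mod M.  Right multiplication by c̄ₛ moves the orbit point by c̄ₛ⁻¹
-- and adds 1 to exp; in the binomial coordinates ψ the former is exactly the spider-web step
-- x₁…x_N ↦ x₂…x_N y, for a letter y depending bijectively on s.  Every pair occurs: c̄₀ fixes 0ᴺ,
-- and N spider-web steps lead from any vertex to any prescribed one.

open import Defs
open import Algebra.Bundles using (AbelianGroup; CommutativeMonoid)
open import Algebra.Structures using (IsAbelianGroup)
import Algebra.Properties.AbelianGroup as AbelianGroupProperties
import Algebra.Properties.CommutativeSemigroup as CommutativeSemigroupProperties
open import Data.Bool using (Bool; true; false; not)
open import Data.Fin using (Fin; toℕ; fromℕ<)
import Data.Fin.Properties as Fin
open import Data.Integer as ℤ using (ℤ; +_; -[1+_]; -_; _-_)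
import Data.Integer.DivMod as ℤDivMod
open import Data.Integer.Divisibility.Signed using (_∣_; divides; ∣ᵤ⇒∣; ∣⇒∣ᵤ)
import Data.Integer.Properties as ℤ
import Data.Integer.Tactic.RingSolver as ℤ-Solver
open import Data.List using (List; []; _∷_; _++_; length)
import Data.List.Properties as List
open import Data.Nat using (ℕ; zero; suc; _+_; _*_; _∸_; _%_; _≤_; _<_; s≤s; NonZero)
open import Data.Nat.DivMod using (_mod_; m<n⇒m%n≡m; %-distribˡ-+; m%n%n≡m%n; [m+n]%n≡m%n; [m+kn]%n≡m%n)
open import Data.Nat.Divisibility using (_∣0)
import Data.Nat.Properties as ℕ
open import Data.Product using (_×_; _,_; proj₁; proj₂)
open import Data.Vec using (Vec; []; _∷_; _∷ʳ_; replicate; zipWith; toList)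
import Data.Vec.Properties as Vec
open import Data.Vec.Relation.Binary.Equality.Cast using (cast-is-id)
open import Level using (0ℓ)
open import Relation.Binary.Bundles using (Setoid)
open import Relation.Binary.PropositionalEquality
import Relation.Binary.Reasoning.Setoid as SetoidReasoning

[m%d+n]%d≡[m+n]%d : ∀ m n d .{{_ : NonZero d}} → (m % d + n) % d ≡ (m + n) % d
[m%d+n]%d≡[m+n]%d m n d = begin
  (m % d + n) % d         ≡⟨ %-distribˡ-+ (m % d) n d ⟩
  (m % d % d + n % d) % d ≡⟨ cong (λ x → (x + n % d) % d) (m%n%n≡m%n m d) ⟩
  (m % d + n % d) % d     ≡⟨ %-distribˡ-+ m n d ⟨
  (m + n) % d             ∎
  where open ≡-Reasoning

[j+1]-1≡j : ∀ j → j ℤ.+ + 1 - + 1 ≡ j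
[j+1]-1≡j = ℤ-Solver.solve-∀

[j-1]+1≡j : ∀ j → j - + 1 ℤ.+ + 1 ≡ j
[j-1]+1≡j = ℤ-Solver.solve-∀

-1+[1+j]≡j : ∀ j → - + 1 ℤ.+ (+ 1 ℤ.+ j) ≡ j
-1+[1+j]≡j = ℤ-Solver.solve-∀

1+[-1+j]≡j : ∀ j → + 1 ℤ.+ (- + 1 ℤ.+ j) ≡ j
1+[-1+j]≡j = ℤ-Solver.solve-∀

i-j+j≡i : ∀ i j → i - j ℤ.+ j ≡ i
i-j+j≡i = ℤ-Solver.solve-∀

i+[j-i]≡j : ∀ i j → i ℤ.+ (j - i) ≡ j
i+[j-i]≡j = ℤ-Solver.solve-∀

suc[j]-i≡suc[j-i] : ∀ i j → + 1 ℤ.+ j - i ≡ + 1 ℤ.+ (j - i)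
suc[j]-i≡suc[j-i] = ℤ-Solver.solve-∀

module _ (k : ℕ) {{_ : NonZero k}} where

  private
    infixl 6 _⊕ₖ_
    _⊕ₖ_ : Fin k → Fin k → Fin k
    _⊕ₖ_ = _⊕_ k

  toℕ-⊕ : ∀ a b → toℕ (a ⊕ₖ b) ≡ (toℕ a + toℕ b) % k
  toℕ-⊕ a b = Fin.toℕ-fromℕ< _

  ⊕-comm : ∀ a b → a ⊕ₖ b ≡ b ⊕ₖ a
  ⊕-comm a b = cong (_mod k) (ℕ.+-comm (toℕ a) (toℕ b))

  ⊕-assoc : ∀ a b c → (a ⊕ₖ b) ⊕ₖ c ≡ a ⊕ₖ (b ⊕ₖ c)
  ⊕-assoc a b c = Fin.toℕ-injective (begin
    toℕ ((a ⊕ₖ b) ⊕ₖ c)                 ≡⟨ toℕ-⊕ (a ⊕ₖ b) c ⟩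
    (toℕ (a ⊕ₖ b) + toℕ c) % k           ≡⟨ cong (λ x → (x + toℕ c) % k) (toℕ-⊕ a b) ⟩
    ((toℕ a + toℕ b) % k + toℕ c) % k    ≡⟨ [m%d+n]%d≡[m+n]%d (toℕ a + toℕ b) (toℕ c) k ⟩
    (toℕ a + toℕ b + toℕ c) % k          ≡⟨ cong (_% k) (ℕ.+-assoc (toℕ a) (toℕ b) (toℕ c)) ⟩
    (toℕ a + (toℕ b + toℕ c)) % k        ≡⟨ cong (_% k) (ℕ.+-comm (toℕ a) _) ⟩
    (toℕ b + toℕ c + toℕ a) % k          ≡⟨ [m%d+n]%d≡[m+n]%d (toℕ b + toℕ c) (toℕ a) k ⟨
    ((toℕ b + toℕ c) % k + toℕ a) % k    ≡⟨ cong (λ x → (x + toℕ a) % k) (toℕ-⊕ b c) ⟨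
    (toℕ (b ⊕ₖ c) + toℕ a) % k           ≡⟨ toℕ-⊕ (b ⊕ₖ c) a ⟨
    toℕ ((b ⊕ₖ c) ⊕ₖ a)                 ≡⟨ cong toℕ (⊕-comm (b ⊕ₖ c) a) ⟩
    toℕ (a ⊕ₖ (b ⊕ₖ c))                 ∎)
    where open ≡-Reasoning

  ⊕-identityˡ : ∀ a → 0k k ⊕ₖ a ≡ a
  ⊕-identityˡ a = Fin.toℕ-injective (begin
    toℕ (0k k ⊕ₖ a)            ≡⟨ toℕ-⊕ (0k k) a ⟩
    (toℕ (0k k) + toℕ a) % k   ≡⟨ cong (λ x → (x + toℕ a) % k) (Fin.toℕ-fromℕ< _) ⟩
    (0 % k + toℕ a) % k        ≡⟨ [m%d+n]%d≡[m+n]%d 0 (toℕ a) k ⟩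
    toℕ a % k                  ≡⟨ m<n⇒m%n≡m (Fin.toℕ<n a) ⟩
    toℕ a                      ∎)
    where open ≡-Reasoning

  ⊕-inverseˡ : ∀ a → ⊖_ k a ⊕ₖ a ≡ 0k k
  ⊕-inverseˡ a = Fin.toℕ-injective (begin
    toℕ (⊖_ k a ⊕ₖ a)                  ≡⟨ toℕ-⊕ (⊖_ k a) a ⟩
    (toℕ (⊖_ k a) + toℕ a) % k         ≡⟨ cong (λ x → (x + toℕ a) % k) (Fin.toℕ-fromℕ< _) ⟩
    ((k ∸ toℕ a) % k + toℕ a) % k      ≡⟨ [m%d+n]%d≡[m+n]%d (k ∸ toℕ a) (toℕ a) k ⟩
    (k ∸ toℕ a + toℕ a) % k            ≡⟨ cong (_% k) (ℕ.m∸n+n≡m (ℕ.<⇒≤ (Fin.toℕ<n a))) ⟩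
    k % k                              ≡⟨ [m+n]%n≡m%n 0 k ⟩
    0 % k                              ≡⟨ Fin.toℕ-fromℕ< _ ⟨
    toℕ (0k k)                         ∎)
    where open ≡-Reasoning

  ⊕-isAbelianGroup : IsAbelianGroup _≡_ _⊕ₖ_ (0k k) (⊖_ k)
  ⊕-isAbelianGroup = record
    { isGroup = record
      { isMonoid = record
        { isSemigroup = record
          { isMagma = record { isEquivalence = isEquivalence ; ∙-cong = cong₂ _⊕ₖ_ }
          ; assoc = ⊕-assoc
          }
        ; identity = ⊕-identityˡ , λ a → trans (⊕-comm a (0k k)) (⊕-identityˡ a)
        }
      ; inverse = ⊕-inverseˡ , λ a → trans (⊕-comm a (⊖_ k a)) (⊕-inverseˡ a)
      ; ⁻¹-cong = cong (⊖_ k)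
      }
    ; comm = ⊕-comm
    }

  ⊕-abelianGroup : AbelianGroup 0ℓ 0ℓ
  ⊕-abelianGroup = record { isAbelianGroup = ⊕-isAbelianGroup }

module Lamplighter (k : ℕ) {{_ : NonZero k}} where
  open AbelianGroup (⊕-abelianGroup k)
    using (_∙_; ε; _⁻¹; assoc; comm; identityˡ; identityʳ; inverseʳ)
  open AbelianGroupProperties (⊕-abelianGroup k)
    using (ε⁻¹≈ε; ⁻¹-∙-comm; //-rightDividesˡ; //-rightDividesʳ; \\-leftDividesˡ; \\-leftDividesʳ;
           ∙-cancelˡ; ⁻¹-anti-homo‿-; xyx⁻¹≈y)
  open CommutativeSemigroupProperties (AbelianGroup.commutativeSemigroup (⊕-abelianGroup k))
    using (interchange)

  V : ℕ → Set
  V = Vec (Fin k)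

  infixl 6 _⊞_
  _⊞_ : ∀ {n} → V n → V n → V n
  _⊞_ = zipWith _∙_

  0ᵛ : ∀ {n} → V n
  0ᵛ = replicate _ ε

  ⊞-commutativeMonoid : ℕ → CommutativeMonoid 0ℓ 0ℓ
  ⊞-commutativeMonoid n = record
    { Carrier = V n
    ; _∙_ = _⊞_
    ; ε = 0ᵛ
    ; isCommutativeMonoid = record
      { isMonoid = record
        { isSemigroup = record
          { isMagma = record { isEquivalence = isEquivalence ; ∙-cong = cong₂ _⊞_ }
          ; assoc = Vec.zipWith-assoc assoc
          }
        ; identity = Vec.zipWith-identityˡ identityˡ , Vec.zipWith-identityʳ identityʳ
        }
      ; comm = Vec.zipWith-comm comm
      }
    }

  module _ {n : ℕ} where
    open CommutativeMonoid (⊞-commutativeMonoid n) public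
      using () renaming (assoc to ⊞-assoc; comm to ⊞-comm; identityˡ to ⊞-identityˡ; identityʳ to ⊞-identityʳ)
    open CommutativeSemigroupProperties (CommutativeMonoid.commutativeSemigroup (⊞-commutativeMonoid n)) public
      using () renaming (interchange to ⊞-interchange)

  -- Reading v : V n as a power series mod tⁿ, T is multiplication by 1 + t.
  T T⁻¹ : ∀ {n} → V n → V n
  T   = actLetter k (ε , true)
  T⁻¹ = actLetter k (ε , false)

  δ : ∀ {n} → Fin k → V n
  δ {zero}  r = []
  δ {suc n} r = r ∷ 0ᵛ

  δ-ε : ∀ {n} → δ {n} ε ≡ 0ᵛ
  δ-ε {zero}  = refl
  δ-ε {suc n} = refl

  δ-∙ : ∀ {n} a b → δ {n} (a ∙ b) ≡ δ a ⊞ δ b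
  δ-∙ {zero}  a b = refl
  δ-∙ {suc n} a b = cong (a ∙ b ∷_) (sym (⊞-identityˡ 0ᵛ))

  actLetter-⊞ : ∀ {n} b p q (u v : V n) →
    actLetter k (p ∙ q , b) (u ⊞ v) ≡ actLetter k (p , b) u ⊞ actLetter k (q , b) v
  actLetter-⊞ true  p q []       []       = refl
  actLetter-⊞ false p q []       []       = refl
  actLetter-⊞ true  p q (u ∷ us) (v ∷ vs) =
    cong₂ _∷_ (interchange u v p q) (actLetter-⊞ true u v us vs)
  actLetter-⊞ false p q (u ∷ us) (v ∷ vs) =
    cong₂ _∷_ head (trans (cong (λ c → actLetter k (c , false) (us ⊞ vs)) head)
                          (actLetter-⊞ false (u ∙ p ⁻¹) (v ∙ q ⁻¹) us vs))
    where
    head : (u ∙ v) ∙ (p ∙ q) ⁻¹ ≡ (u ∙ p ⁻¹) ∙ (v ∙ q ⁻¹)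
    head = trans (cong (u ∙ v ∙_) (sym (⁻¹-∙-comm p q))) (interchange u v (p ⁻¹) (q ⁻¹))

  actLetter₀-⊞ : ∀ {n} b (u v : V n) →
    actLetter k (ε , b) (u ⊞ v) ≡ actLetter k (ε , b) u ⊞ actLetter k (ε , b) v
  actLetter₀-⊞ b u v =
    trans (cong (λ c → actLetter k (c , b) (u ⊞ v)) (sym (identityˡ ε))) (actLetter-⊞ b ε ε u v)

  actLetter₀-0ᵛ : ∀ {n} b → actLetter k (ε , b) (0ᵛ {n}) ≡ 0ᵛ
  actLetter₀-0ᵛ {zero}  true  = refl
  actLetter₀-0ᵛ {zero}  false = refl
  actLetter₀-0ᵛ {suc n} true  = cong₂ _∷_ (identityˡ ε) (actLetter₀-0ᵛ true)
  actLetter₀-0ᵛ {suc n} false =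
    cong₂ _∷_ (inverseʳ ε) (trans (cong (λ c → actLetter k (c , false) 0ᵛ) (inverseʳ ε)) (actLetter₀-0ᵛ false))

  c̄-c̄⁻¹ : ∀ {n} r (v : V n) → actLetter k (r , true) (actLetter k (r , false) v) ≡ v
  c̄-c̄⁻¹ r []       = refl
  c̄-c̄⁻¹ r (x ∷ xs) = cong₂ _∷_ (//-rightDividesˡ r x) (c̄-c̄⁻¹ (x ∙ r ⁻¹) xs)

  c̄⁻¹-c̄ : ∀ {n} r (v : V n) → actLetter k (r , false) (actLetter k (r , true) v) ≡ v
  c̄⁻¹-c̄ r []       = refl
  c̄⁻¹-c̄ r (x ∷ xs) =
    cong₂ _∷_ x∙r∙r⁻¹≡x (trans (cong (λ c → actLetter k (c , false) (actLetter k (x , true) xs)) x∙r∙r⁻¹≡x)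
                             (c̄⁻¹-c̄ x xs))
    where
    x∙r∙r⁻¹≡x : x ∙ r ∙ r ⁻¹ ≡ x
    x∙r∙r⁻¹≡x = //-rightDividesʳ r x

  c̄-affine : ∀ {n} r (v : V n) → actLetter k (r , true) v ≡ T v ⊞ δ r
  c̄-affine r []       = refl
  c̄-affine r (x ∷ xs) = cong₂ _∷_ (cong (_∙ r) (sym (identityʳ x))) (sym (⊞-identityʳ _))

  c̄⁻¹-affine : ∀ {n} r (v : V n) → actLetter k (r , false) v ≡ T⁻¹ (v ⊞ δ (r ⁻¹))
  c̄⁻¹-affine r []       = refl
  c̄⁻¹-affine r (x ∷ xs) =
    sym (cong₂ (λ c w → c ∷ actLetter k (c , false) w) y∙ε⁻¹≡y (⊞-identityʳ xs))
    where
    y∙ε⁻¹≡y : (x ∙ r ⁻¹) ∙ ε ⁻¹ ≡ x ∙ r ⁻¹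
    y∙ε⁻¹≡y = trans (cong (x ∙ r ⁻¹ ∙_) ε⁻¹≈ε) (identityʳ _)

  T^ : ∀ {n} → ℤ → V n → V n
  T^ (+ zero)      v = v
  T^ (+ suc m)     v = T (T^ (+ m) v)
  T^ -[1+ zero ]   v = T⁻¹ v
  T^ -[1+ suc m ]  v = T⁻¹ (T^ -[1+ m ] v)

  T^-⊞ : ∀ {n} z (u v : V n) → T^ z (u ⊞ v) ≡ T^ z u ⊞ T^ z v
  T^-⊞ (+ zero)     u v = refl
  T^-⊞ (+ suc m)    u v = trans (cong T (T^-⊞ (+ m) u v)) (actLetter₀-⊞ true _ _)
  T^-⊞ -[1+ zero ]  u v = actLetter₀-⊞ false u v
  T^-⊞ -[1+ suc m ] u v = trans (cong T⁻¹ (T^-⊞ -[1+ m ] u v)) (actLetter₀-⊞ false _ _)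

  T^-0ᵛ : ∀ {n} z → T^ z (0ᵛ {n}) ≡ 0ᵛ
  T^-0ᵛ (+ zero)     = refl
  T^-0ᵛ (+ suc m)    = trans (cong T (T^-0ᵛ (+ m))) (actLetter₀-0ᵛ true)
  T^-0ᵛ -[1+ zero ]  = actLetter₀-0ᵛ false
  T^-0ᵛ -[1+ suc m ] = trans (cong T⁻¹ (T^-0ᵛ -[1+ m ])) (actLetter₀-0ᵛ false)

  T^-δ-ε : ∀ {n} z → T^ z (δ {n} ε) ≡ 0ᵛ
  T^-δ-ε z = trans (cong (T^ z) δ-ε) (T^-0ᵛ z)

  letterExp : Bool → ℤ
  letterExp true  = + 1
  letterExp false = -[1+ 0 ]

  T^-step : ∀ {n} b z (v : V n) → actLetter k (ε , b) (T^ z v) ≡ T^ (letterExp b ℤ.+ z) v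
  T^-step true  (+ m)          v = refl
  T^-step true  -[1+ zero ]    v = c̄-c̄⁻¹ ε v
  T^-step true  -[1+ suc m ]   v = c̄-c̄⁻¹ ε (T^ -[1+ m ] v)
  T^-step false (+ zero)       v = refl
  T^-step false (+ suc m)      v = c̄⁻¹-c̄ ε (T^ (+ m) v)
  T^-step false -[1+ m ]       v = refl

  lampSum : ∀ {n} → (ℤ → Fin k) → ℤ → ℕ → V n
  lampSum f a zero      = 0ᵛ
  lampSum f a (suc len) = T^ a (δ (f a)) ⊞ lampSum f (ℤ.suc a) len

  lampSum-cong : ∀ {n f g} → (∀ j → f j ≡ g j) → ∀ a len → lampSum {n} f a len ≡ lampSum g a len
  lampSum-cong f≗g a zero      = refl
  lampSum-cong f≗g a (suc len) =
    cong₂ (λ c w → T^ a (δ c) ⊞ w) (f≗g a) (lampSum-cong f≗g (ℤ.suc a) len)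

  lampSum-ε : ∀ {n} a len → lampSum {n} (λ _ → ε) a len ≡ 0ᵛ
  lampSum-ε a zero      = refl
  lampSum-ε a (suc len) =
    trans (cong₂ _⊞_ (T^-δ-ε a) (lampSum-ε (ℤ.suc a) len)) (⊞-identityˡ 0ᵛ)

  lampSum-∙ : ∀ {n} f g a len →
    lampSum {n} (λ j → f j ∙ g j) a len ≡ lampSum f a len ⊞ lampSum g a len
  lampSum-∙ f g a zero      = sym (⊞-identityˡ 0ᵛ)
  lampSum-∙ f g a (suc len) = begin
    T^ a (δ (f a ∙ g a)) ⊞ lampSum (λ j → f j ∙ g j) (ℤ.suc a) len
      ≡⟨ cong₂ _⊞_ (trans (cong (T^ a) (δ-∙ (f a) (g a))) (T^-⊞ a _ _)) (lampSum-∙ f g (ℤ.suc a) len) ⟩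
    (T^ a (δ (f a)) ⊞ T^ a (δ (g a))) ⊞ (lampSum f (ℤ.suc a) len ⊞ lampSum g (ℤ.suc a) len)
      ≡⟨ ⊞-interchange _ _ _ _ ⟩
    (T^ a (δ (f a)) ⊞ lampSum f (ℤ.suc a) len) ⊞ (T^ a (δ (g a)) ⊞ lampSum g (ℤ.suc a) len)
      ∎
    where open ≡-Reasoning

  lampSum-δ₀ : ∀ {n} c A B → lampSum {n} (δ₀ k c) (- + A) (A + suc B) ≡ δ c
  lampSum-δ₀ {n} c zero    B = trans (cong (δ c ⊞_) (vanishes 0 B)) (⊞-identityʳ (δ c))
    where
    vanishes : ∀ m len → lampSum {n} (δ₀ k c) (+ suc m) len ≡ 0ᵛ
    vanishes m zero      = refl
    vanishes m (suc len) =
      trans (cong₂ _⊞_ (T^-δ-ε (+ suc m)) (vanishes (suc m) len)) (⊞-identityˡ 0ᵛ)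
  lampSum-δ₀ c (suc A) B = begin
    T^ -[1+ A ] (δ ε) ⊞ lampSum (δ₀ k c) (ℤ.suc -[1+ A ]) (A + suc B)
      ≡⟨ cong₂ _⊞_ (T^-δ-ε -[1+ A ]) (cong (λ a → lampSum (δ₀ k c) a (A + suc B)) (suc-neg A)) ⟩
    0ᵛ ⊞ lampSum (δ₀ k c) (- + A) (A + suc B)
      ≡⟨ ⊞-identityˡ _ ⟩
    lampSum (δ₀ k c) (- + A) (A + suc B)
      ≡⟨ lampSum-δ₀ c A B ⟩
    δ c ∎
    where
    open ≡-Reasoning
    suc-neg : ∀ A → ℤ.suc -[1+ A ] ≡ - + A
    suc-neg zero    = refl
    suc-neg (suc A) = refl

  lampSum-shift : ∀ {n} b f a len →
    lampSum {n} (λ j → f (j - letterExp b)) a len ≡ actLetter k (ε , b) (lampSum f (a - letterExp b) len)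
  lampSum-shift b f a zero      = sym (actLetter₀-0ᵛ b)
  lampSum-shift b f a (suc len) = begin
    T^ a (δ (f (a - u))) ⊞ lampSum (λ j → f (j - u)) (ℤ.suc a) len
      ≡⟨ cong₂ _⊞_ (cong (λ z → T^ z (δ (f (a - u)))) (sym (i+[j-i]≡j u a))) (lampSum-shift b f (ℤ.suc a) len) ⟩
    T^ (u ℤ.+ (a - u)) (δ (f (a - u))) ⊞ actLetter k (ε , b) (lampSum f (ℤ.suc a - u) len)
      ≡⟨ cong₂ _⊞_ (T^-step b (a - u) _) (cong (λ z → actLetter k (ε , b) (lampSum f z len)) (sym (suc[j]-i≡suc[j-i] u a))) ⟨
    actLetter k (ε , b) (T^ (a - u) (δ (f (a - u)))) ⊞ actLetter k (ε , b) (lampSum f (ℤ.suc (a - u)) len)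
      ≡⟨ actLetter₀-⊞ b _ _ ⟨
    actLetter k (ε , b) (T^ (a - u) (δ (f (a - u))) ⊞ lampSum f (ℤ.suc (a - u)) len)
      ∎
    where
    open ≡-Reasoning
    u = letterExp b

  δ₀-⁻¹ : ∀ r j → δ₀ k r j ⁻¹ ≡ δ₀ k (r ⁻¹) j
  δ₀-⁻¹ r (+ zero)  = refl
  δ₀-⁻¹ r (+ suc _) = ε⁻¹≈ε
  δ₀-⁻¹ r -[1+ _ ]  = ε⁻¹≈ε

  -- x ↦ (1+t)ᶻ x + Σ_{-A ≤ j ≤ B} f(j) (1+t)ʲ; this is the action of ⟨ f , z ⟩ as soon as the
  -- window [-A, B] contains all its lamps (act≡lampAct).
  lampAct : ∀ {n} → ℕ → ℕ → Lamp k → V n → V n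
  lampAct A B g x = T^ (pos g) x ⊞ lampSum (lamps g) (- + A) (A + suc B)

  lampAct-c̄ : ∀ {n} A B r g (x : V n) →
    lampAct A (suc B) (_·_ k (c̄ k r) g) x ≡ actLetter k (r , true) (lampAct (suc A) B g x)
  lampAct-c̄ A B r g x = begin
    T^ (+ 1 ℤ.+ pos g) x ⊞ lampSum (λ j → δ₀ k r j ∙ lamps g (j - + 1)) (- + A) L
      ≡⟨ cong (_ ⊞_) (lampSum-∙ (δ₀ k r) (λ j → lamps g (j - + 1)) (- + A) L) ⟩
    T^ (+ 1 ℤ.+ pos g) x ⊞ (lampSum (δ₀ k r) (- + A) L ⊞ lampSum (λ j → lamps g (j - + 1)) (- + A) L)
      ≡⟨ cong₂ (λ u w → y ⊞ (u ⊞ w)) (lampSum-δ₀ r A (suc B)) (lampSum-shift true (lamps g) (- + A) L) ⟩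
    T^ (+ 1 ℤ.+ pos g) x ⊞ (δ r ⊞ T (lampSum (lamps g) (- + A - + 1) L))
      ≡⟨ cong₂ (λ a l → y ⊞ (δ r ⊞ T (lampSum (lamps g) a l))) (-A-1≡-[1+A] A) (ℕ.+-suc A (suc B)) ⟩
    T^ (+ 1 ℤ.+ pos g) x ⊞ (δ r ⊞ T S)
      ≡⟨ cong (_ ⊞_) (⊞-comm _ _) ⟩
    T^ (+ 1 ℤ.+ pos g) x ⊞ (T S ⊞ δ r)
      ≡⟨ ⊞-assoc _ _ _ ⟨
    T^ (+ 1 ℤ.+ pos g) x ⊞ T S ⊞ δ r
      ≡⟨ cong (λ z → z ⊞ T S ⊞ δ r) (T^-step true (pos g) x) ⟨
    T (T^ (pos g) x) ⊞ T S ⊞ δ r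
      ≡⟨ cong (_⊞ δ r) (actLetter₀-⊞ true _ _) ⟨
    T (T^ (pos g) x ⊞ S) ⊞ δ r
      ≡⟨ c̄-affine r _ ⟨
    actLetter k (r , true) (T^ (pos g) x ⊞ S)
      ∎
    where
    open ≡-Reasoning
    y = T^ (+ 1 ℤ.+ pos g) x
    L = A + suc (suc B)
    S = lampSum (lamps g) (- + suc A) (suc A + suc B)
    -A-1≡-[1+A] : ∀ A → - + A - + 1 ≡ - + suc A
    -A-1≡-[1+A] zero    = refl
    -A-1≡-[1+A] (suc A) = cong (λ m → -[1+ suc m ]) (ℕ.+-identityʳ A)

  lampAct-c̄⁻¹ : ∀ {n} A B r g (x : V n) →
    lampAct (suc A) B (_·_ k (lampInv k (c̄ k r)) g) x ≡ actLetter k (r , false) (lampAct A (suc B) g x)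
  lampAct-c̄⁻¹ A B r g x = begin
    T^ (-[1+ 0 ] ℤ.+ pos g) x ⊞ lampSum (λ j → h (j ℤ.+ + 1)) -[1+ A ] (suc A + suc B)
      ≡⟨ cong (_ ⊞_) (lampSum-shift false h -[1+ A ] (suc A + suc B)) ⟩
    T^ (-[1+ 0 ] ℤ.+ pos g) x ⊞ T⁻¹ (lampSum h (-[1+ A ] ℤ.+ + 1) (suc A + suc B))
      ≡⟨ cong₂ (λ a l → y ⊞ T⁻¹ (lampSum h a l)) (-[1+A]+1≡-A A) (sym (ℕ.+-suc A (suc B))) ⟩
    T^ (-[1+ 0 ] ℤ.+ pos g) x ⊞ T⁻¹ (lampSum h (- + A) L)
      ≡⟨ cong (λ w → y ⊞ T⁻¹ w) (lampSum-∙ (λ j → δ₀ k r j ⁻¹) (lamps g) (- + A) L) ⟩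
    T^ (-[1+ 0 ] ℤ.+ pos g) x ⊞ T⁻¹ (lampSum (λ j → δ₀ k r j ⁻¹) (- + A) L ⊞ S)
      ≡⟨ cong (λ w → y ⊞ T⁻¹ (w ⊞ S)) (trans (lampSum-cong (δ₀-⁻¹ r) (- + A) L) (lampSum-δ₀ (r ⁻¹) A (suc B))) ⟩
    T^ (-[1+ 0 ] ℤ.+ pos g) x ⊞ T⁻¹ (δ (r ⁻¹) ⊞ S)
      ≡⟨ cong₂ _⊞_ (T^-step false (pos g) x) refl ⟨
    T⁻¹ (T^ (pos g) x) ⊞ T⁻¹ (δ (r ⁻¹) ⊞ S)
      ≡⟨ actLetter₀-⊞ false _ _ ⟨
    T⁻¹ (T^ (pos g) x ⊞ (δ (r ⁻¹) ⊞ S))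
      ≡⟨ cong (λ w → T⁻¹ (_ ⊞ w)) (⊞-comm _ _) ⟩
    T⁻¹ (T^ (pos g) x ⊞ (S ⊞ δ (r ⁻¹)))
      ≡⟨ cong T⁻¹ (⊞-assoc _ _ _) ⟨
    T⁻¹ (T^ (pos g) x ⊞ S ⊞ δ (r ⁻¹))
      ≡⟨ c̄⁻¹-affine r _ ⟨
    actLetter k (r , false) (T^ (pos g) x ⊞ S)
      ∎
    where
    open ≡-Reasoning
    h : ℤ → Fin k
    h j = δ₀ k r j ⁻¹ ∙ lamps g j
    y = T^ (-[1+ 0 ] ℤ.+ pos g) x
    L = A + suc (suc B)
    S = lampSum (lamps g) (- + A) L
    -[1+A]+1≡-A : ∀ A → -[1+ A ] ℤ.+ + 1 ≡ - + A
    -[1+A]+1≡-A zero    = refl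
    -[1+A]+1≡-A (suc A) = refl

  act≡lampAct : ∀ {n} w {A B} → length w ≤ A → length w ≤ B → (x : V n) →
    act k w x ≡ lampAct A B (eval k w) x
  act≡lampAct []                {A} {B}     _         _         x =
    sym (trans (cong (x ⊞_) (lampSum-ε (- + A) (A + suc B))) (⊞-identityʳ x))
  act≡lampAct ((r , true)  ∷ w) {A} {suc B} w<A       (s≤s w≤B) x = trans
    (cong (actLetter k (r , true)) (act≡lampAct w (ℕ.m≤n⇒m≤1+n (ℕ.<⇒≤ w<A)) w≤B x))
    (sym (lampAct-c̄ A B r (eval k w) x))
  act≡lampAct ((r , false) ∷ w) {suc A} {B} (s≤s w≤A) w<B       x = trans
    (cong (actLetter k (r , false)) (act≡lampAct w w≤A (ℕ.m≤n⇒m≤1+n (ℕ.<⇒≤ w<B)) x))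
    (sym (lampAct-c̄⁻¹ A B r (eval k w) x))

  act-cong : ∀ {n} g h → _=L_ k g h → (v : V n) → act k g v ≡ act k h v
  act-cong g h (lamps≗ , pos≡) v = begin
    act k g v                 ≡⟨ act≡lampAct g (ℕ.m≤m+n |g| |h|) (ℕ.m≤m+n |g| |h|) v ⟩
    lampAct C C (eval k g) v  ≡⟨ cong₂ _⊞_ (cong (λ z → T^ z v) pos≡) (lampSum-cong lamps≗ (- + C) (C + suc C)) ⟩
    lampAct C C (eval k h) v  ≡⟨ act≡lampAct h (ℕ.m≤n+m |h| |g|) (ℕ.m≤n+m |h| |g|) v ⟨
    act k h v                 ∎
    where
    open ≡-Reasoning
    |g| = length g
    |h| = length h
    C = |g| + |h|

  flip : Letter k → Letter k
  flip (r , b) = r , not b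

  actLetter-flip : ∀ {n} l (v : V n) → actLetter k l (actLetter k (flip l) v) ≡ v
  actLetter-flip (r , true)  = c̄-c̄⁻¹ r
  actLetter-flip (r , false) = c̄⁻¹-c̄ r

  flip-actLetter : ∀ {n} l (v : V n) → actLetter k (flip l) (actLetter k l v) ≡ v
  flip-actLetter (r , true)  = c̄⁻¹-c̄ r
  flip-actLetter (r , false) = c̄-c̄⁻¹ r

  inverse : Word k → Word k
  inverse []      = []
  inverse (l ∷ w) = inverse w ++ flip l ∷ []

  inverse-++ : ∀ u w → inverse (u ++ w) ≡ inverse w ++ inverse u
  inverse-++ []      w = sym (List.++-identityʳ (inverse w))
  inverse-++ (l ∷ u) w =
    trans (cong (_++ flip l ∷ []) (inverse-++ u w)) (List.++-assoc (inverse w) (inverse u) (flip l ∷ []))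

  act-++ : ∀ {n} u w (v : V n) → act k (u ++ w) v ≡ act k u (act k w v)
  act-++ []      w v = refl
  act-++ (l ∷ u) w v = cong (actLetter k l) (act-++ u w v)

  act-act-inverse : ∀ {n} w (v : V n) → act k w (act k (inverse w) v) ≡ v
  act-act-inverse []      v = refl
  act-act-inverse (l ∷ w) v = begin
    actLetter k l (act k w (act k (inverse w ++ flip l ∷ []) v))
      ≡⟨ cong (λ u → actLetter k l (act k w u)) (act-++ (inverse w) (flip l ∷ []) v) ⟩
    actLetter k l (act k w (act k (inverse w) (actLetter k (flip l) v)))
      ≡⟨ cong (actLetter k l) (act-act-inverse w _) ⟩
    actLetter k l (actLetter k (flip l) v)
      ≡⟨ actLetter-flip l v ⟩
    v ∎
    where open ≡-Reasoning

  act-inverse-act : ∀ {n} w (v : V n) → act k (inverse w) (act k w v) ≡ v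
  act-inverse-act []      v = refl
  act-inverse-act (l ∷ w) v = begin
    act k (inverse w ++ flip l ∷ []) (actLetter k l (act k w v))
      ≡⟨ act-++ (inverse w) (flip l ∷ []) _ ⟩
    act k (inverse w) (actLetter k (flip l) (actLetter k l (act k w v)))
      ≡⟨ cong (act k (inverse w)) (flip-actLetter l _) ⟩
    act k (inverse w) (act k w v)
      ≡⟨ act-inverse-act w v ⟩
    v ∎
    where open ≡-Reasoning

  expX-++ : ∀ u w → expX k (u ++ w) ≡ expX k u ℤ.+ expX k w
  expX-++ []               w = sym (ℤ.+-identityˡ (expX k w))
  expX-++ ((_ , true) ∷ u)  w = trans (cong (ℤ._+_ (+ 1)) (expX-++ u w)) (sym (ℤ.+-assoc (+ 1) (expX k u) (expX k w)))
  expX-++ ((_ , false) ∷ u) w = trans (cong (ℤ._+_ -[1+ 0 ]) (expX-++ u w)) (sym (ℤ.+-assoc -[1+ 0 ] (expX k u) (expX k w)))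

  expX-inverse : ∀ w → expX k (inverse w) ≡ - expX k w
  expX-inverse []               = refl
  expX-inverse ((r , true) ∷ w)  = begin
    expX k (inverse w ++ (r , false) ∷ [])  ≡⟨ expX-++ (inverse w) _ ⟩
    expX k (inverse w) ℤ.+ -[1+ 0 ]         ≡⟨ cong (ℤ._+ -[1+ 0 ]) (expX-inverse w) ⟩
    - expX k w ℤ.+ -[1+ 0 ]                 ≡⟨ ℤ.+-comm (- expX k w) -[1+ 0 ] ⟩
    - + 1 ℤ.+ - expX k w                    ≡⟨ ℤ.neg-distrib-+ (+ 1) (expX k w) ⟨
    - (+ 1 ℤ.+ expX k w)                    ∎
    where open ≡-Reasoning
  expX-inverse ((r , false) ∷ w) = begin
    expX k (inverse w ++ (r , true) ∷ [])   ≡⟨ expX-++ (inverse w) _ ⟩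
    expX k (inverse w) ℤ.+ + 1              ≡⟨ cong (ℤ._+ + 1) (expX-inverse w) ⟩
    - expX k w ℤ.+ + 1                      ≡⟨ ℤ.+-comm (- expX k w) (+ 1) ⟩
    - -[1+ 0 ] ℤ.+ - expX k w               ≡⟨ ℤ.neg-distrib-+ -[1+ 0 ] (expX k w) ⟨
    - (-[1+ 0 ] ℤ.+ expX k w)               ∎
    where open ≡-Reasoning

  pos-eval : ∀ w → pos (eval k w) ≡ expX k w
  pos-eval []               = refl
  pos-eval ((_ , true) ∷ w)  = cong (ℤ._+_ (+ 1)) (pos-eval w)
  pos-eval ((_ , false) ∷ w) = cong (ℤ._+_ -[1+ 0 ]) (pos-eval w)

  =L-setoid : Setoid 0ℓ 0ℓ
  =L-setoid = record
    { Carrier = Word k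
    ; _≈_ = _=L_ k
    ; isEquivalence = record
      { refl  = (λ _ → refl) , refl
      ; sym   = λ (lamps≗ , pos≡) → (λ j → sym (lamps≗ j)) , sym pos≡
      ; trans = λ (lamps≗ , pos≡) (lamps≗′ , pos≡′) → (λ j → trans (lamps≗ j) (lamps≗′ j)) , trans pos≡ pos≡′
      }
    }
  open Setoid =L-setoid public using () renaming (refl to =L-refl)

  ++-congˡ : ∀ a {u w} → _=L_ k u w → _=L_ k (a ++ u) (a ++ w)
  ++-congˡ []      u=w = u=w
  ++-congˡ (l ∷ a) u=w with ++-congˡ a u=w
  ... | lamps≗ , pos≡ =
    (λ j → cong (lamps (evalLetter k l) j ∙_) (lamps≗ (j - pos (evalLetter k l)))) ,
    cong (ℤ._+_ (pos (evalLetter k l))) pos≡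

  flip-cancel : ∀ l w → _=L_ k (flip l ∷ l ∷ w) w
  flip-cancel (r , true) w =
    (λ j → trans (\\-leftDividesʳ (δ₀ k r (j ℤ.+ + 1)) _) (cong (lamps (eval k w)) ([j+1]-1≡j j))) ,
    -1+[1+j]≡j (pos (eval k w))
  flip-cancel (r , false) w =
    (λ j → trans (cong (λ i → δ₀ k r j ∙ (δ₀ k r i ⁻¹ ∙ lamps (eval k w) i)) ([j-1]+1≡j j))
                 (\\-leftDividesˡ (δ₀ k r j) _)) ,
    1+[-1+j]≡j (pos (eval k w))

  inverse-++-cancel : ∀ w → _=L_ k (inverse w ++ w) []
  inverse-++-cancel []      = =L-refl {[]}
  inverse-++-cancel (l ∷ w) = begin
    (inverse w ++ flip l ∷ []) ++ l ∷ w  ≡⟨ List.++-assoc (inverse w) (flip l ∷ []) (l ∷ w) ⟩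
    inverse w ++ flip l ∷ l ∷ w          ≈⟨ ++-congˡ (inverse w) (flip-cancel l w) ⟩
    inverse w ++ w                       ≈⟨ inverse-++-cancel w ⟩
    []                                   ∎
    where open SetoidReasoning =L-setoid

  binomialSum : ∀ {m} → Fin k → V m → Fin k
  binomialSum p []       = p
  binomialSum p (u ∷ us) = binomialSum (u ∙ p) (actLetter k (u , true) us)

  binomialSum-∙ : ∀ {m} p q (us : V m) → binomialSum (p ∙ q) us ≡ binomialSum p us ∙ q
  binomialSum-∙ p q []       = refl
  binomialSum-∙ p q (u ∷ us) =
    trans (cong (λ c → binomialSum c (actLetter k (u , true) us)) (sym (assoc u p q)))
          (binomialSum-∙ (u ∙ p) q (actLetter k (u , true) us))

  binomialSum-c̄⁻¹ : ∀ {m} p u (us : V m) → binomialSum p (actLetter k (p , false) (u ∷ us)) ≡ binomialSum u us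
  binomialSum-c̄⁻¹ p u us = cong₂ binomialSum (//-rightDividesˡ p u) (c̄-c̄⁻¹ (u ∙ p ⁻¹) us)

  -- (ψ v)ᵢ = Σ_{j ≥ i} C(n-1-i, j-i) vⱼ.
  ψ : ∀ {n} → V n → V n
  ψ []       = []
  ψ (v ∷ vs) = binomialSum v vs ∷ ψ vs

  ψ-injective : ∀ {n} (u v : V n) → ψ u ≡ ψ v → u ≡ v
  ψ-injective []       []       _  = refl
  ψ-injective (u ∷ us) (v ∷ vs) eq with ψ-injective us vs (Vec.∷-injectiveʳ eq)
  ... | refl = cong (_∷ us) (∙-cancelˡ (binomialSum ε us) u v (begin
    binomialSum ε us ∙ u   ≡⟨ binomialSum-∙ ε u us ⟨
    binomialSum (ε ∙ u) us ≡⟨ cong (λ c → binomialSum c us) (identityˡ u) ⟩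
    binomialSum u us       ≡⟨ Vec.∷-injectiveˡ eq ⟩
    binomialSum v us       ≡⟨ cong (λ c → binomialSum c us) (identityˡ v) ⟨
    binomialSum (ε ∙ v) us ≡⟨ binomialSum-∙ ε v us ⟩
    binomialSum ε us ∙ v   ∎))
    where open ≡-Reasoning

  x∙[x∙y⁻¹]⁻¹≡y : ∀ x y → x ∙ (x ∙ y ⁻¹) ⁻¹ ≡ y
  x∙[x∙y⁻¹]⁻¹≡y x y = trans (cong (x ∙_) (⁻¹-anti-homo‿- x y)) (trans (sym (assoc x y (x ⁻¹))) (xyx⁻¹≈y x y))

  newLetter : ∀ {n} → V n → Fin k → Fin k
  newLetter []       s = s
  newLetter (v ∷ vs) s = newLetter vs (v ∙ s ⁻¹)

  letterFor : ∀ {n} → V n → Fin k → Fin k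
  letterFor []       y = y
  letterFor (v ∷ vs) y = v ∙ letterFor vs y ⁻¹

  newLetter-letterFor : ∀ {n} (v : V n) y → newLetter v (letterFor v y) ≡ y
  newLetter-letterFor []       y = refl
  newLetter-letterFor (v ∷ vs) y = trans (cong (newLetter vs) (x∙[x∙y⁻¹]⁻¹≡y v _)) (newLetter-letterFor vs y)

  letterFor-newLetter : ∀ {n} (v : V n) s → letterFor v (newLetter v s) ≡ s
  letterFor-newLetter []       s = refl
  letterFor-newLetter (v ∷ vs) s =
    trans (cong (λ c → v ∙ c ⁻¹) (letterFor-newLetter vs (v ∙ s ⁻¹))) (x∙[x∙y⁻¹]⁻¹≡y v s)

  ψ-c̄⁻¹ : ∀ {n} (v : V n) s → ψ (actLetter k (s , false) v) ≡ shiftIn k (ψ v) (newLetter v s)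
  ψ-c̄⁻¹ []           s = refl
  ψ-c̄⁻¹ (v ∷ [])     s = refl
  ψ-c̄⁻¹ (v ∷ u ∷ us) s = cong₂ _∷_ (binomialSum-c̄⁻¹ (v ∙ s ⁻¹) u us) (ψ-c̄⁻¹ (u ∷ us) (v ∙ s ⁻¹))

  path : ∀ {n m} → V n → V m → Word k
  path v []       = []
  path v (y ∷ ys) = (letterFor v y , true) ∷ path (actLetter k (letterFor v y , false) v) ys

  shiftInAll : ∀ {n m} → V n → V m → V n
  shiftInAll z []       = z
  shiftInAll z (y ∷ ys) = shiftInAll (shiftIn k z y) ys

  ψ-path : ∀ {n m} (v : V n) (ys : V m) → ψ (act k (inverse (path v ys)) v) ≡ shiftInAll (ψ v) ys
  ψ-path v []       = refl
  ψ-path v (y ∷ ys) = begin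
    ψ (act k (inverse (path v′ ys) ++ (s , false) ∷ []) v)  ≡⟨ cong ψ (act-++ (inverse (path v′ ys)) _ v) ⟩
    ψ (act k (inverse (path v′ ys)) v′)                     ≡⟨ ψ-path v′ ys ⟩
    shiftInAll (ψ v′) ys                                    ≡⟨ cong (λ z → shiftInAll z ys) (ψ-c̄⁻¹ v s) ⟩
    shiftInAll (shiftIn k (ψ v) (newLetter v s)) ys
      ≡⟨ cong (λ c → shiftInAll (shiftIn k (ψ v) c) ys) (newLetter-letterFor v y) ⟩
    shiftInAll (shiftIn k (ψ v) y) ys                       ∎
    where
    open ≡-Reasoning
    s  = letterFor v y
    v′ = actLetter k (s , false) v

  toList-shiftInAll : ∀ {n m} (z : V n) (ys : V m) L W → length L ≡ m → toList z ≡ L ++ W →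
    toList (shiftInAll z ys) ≡ W ++ toList ys
  toList-shiftInAll z       []       []      W _  z≡W = trans z≡W (sym (List.++-identityʳ W))
  toList-shiftInAll []      (y ∷ ys) (_ ∷ L) W _  ()
  toList-shiftInAll (a ∷ z) (y ∷ ys) (_ ∷ L) W eq z≡L++W = begin
    toList (shiftInAll (z ∷ʳ y) ys)  ≡⟨ toList-shiftInAll (z ∷ʳ y) ys L (W ++ y ∷ []) (ℕ.suc-injective eq) z∷ʳy≡L++W++y ⟩
    (W ++ y ∷ []) ++ toList ys       ≡⟨ List.++-assoc W (y ∷ []) (toList ys) ⟩
    W ++ y ∷ toList ys               ∎
    where
    open ≡-Reasoning
    z∷ʳy≡L++W++y : toList (z ∷ʳ y) ≡ L ++ W ++ y ∷ []
    z∷ʳy≡L++W++y = begin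
      toList (z ∷ʳ y)     ≡⟨ Vec.toList-∷ʳ y z ⟩
      toList z ++ y ∷ []  ≡⟨ cong (_++ y ∷ []) (List.∷-injectiveʳ z≡L++W) ⟩
      (L ++ W) ++ y ∷ []  ≡⟨ List.++-assoc L W (y ∷ []) ⟩
      L ++ W ++ y ∷ []    ∎

  shiftInAll-self : ∀ {n} (z x : V n) → shiftInAll z x ≡ x
  shiftInAll-self z x = trans (sym (cast-is-id refl (shiftInAll z x)))
    (Vec.toList-injective refl (shiftInAll z x) x
      (toList-shiftInAll z x (toList z) [] (Vec.length-toList z) (sym (List.++-identityʳ (toList z)))))

  act-inverse-fixed : ∀ {n} w (v : V n) → act k w v ≡ v → act k (inverse w) v ≡ v
  act-inverse-fixed w v w·v≡v = trans (cong (act k (inverse w)) (sym w·v≡v)) (act-inverse-act w v)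

  expX-path : ∀ {n m} (v : V n) (ys : V m) → expX k (path v ys) ≡ + m
  expX-path v []       = refl
  expX-path v (y ∷ ys) = cong (ℤ._+_ (+ 1)) (expX-path _ ys)

  c̄₀^ : ℤ → Word k
  c̄₀^ (+ zero)      = []
  c̄₀^ (+ suc m)     = (ε , true) ∷ c̄₀^ (+ m)
  c̄₀^ -[1+ zero ]   = (ε , false) ∷ []
  c̄₀^ -[1+ suc m ]  = (ε , false) ∷ c̄₀^ -[1+ m ]

  act-c̄₀^ : ∀ {n} z (v : V n) → act k (c̄₀^ z) v ≡ T^ z v
  act-c̄₀^ (+ zero)      v = refl
  act-c̄₀^ (+ suc m)     v = cong T (act-c̄₀^ (+ m) v)
  act-c̄₀^ -[1+ zero ]   v = refl
  act-c̄₀^ -[1+ suc m ]  v = cong T⁻¹ (act-c̄₀^ -[1+ m ] v)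

  expX-c̄₀^ : ∀ z → expX k (c̄₀^ z) ≡ z
  expX-c̄₀^ (+ zero)      = refl
  expX-c̄₀^ (+ suc m)     = cong (ℤ._+_ (+ 1)) (expX-c̄₀^ (+ m))
  expX-c̄₀^ -[1+ zero ]   = refl
  expX-c̄₀^ -[1+ suc m ]  = cong (ℤ._+_ -[1+ 0 ]) (expX-c̄₀^ -[1+ m ])

module Residues (m : ℕ) .{{_ : NonZero m}} where

  private
    i≡j+k⇒j≡i-k : ∀ {i j k} → i ≡ j ℤ.+ k → j ≡ i ℤ.+ - k
    i≡j+k⇒j≡i-k {j = j} {k} refl = solve j k
      where solve : ∀ j k → j ≡ j ℤ.+ k ℤ.+ - k
            solve = ℤ-Solver.solve-∀

    [r+p*n]-[r+q*n]≡[p-q]*n : ∀ r p q n → (r ℤ.+ p ℤ.* n) - (r ℤ.+ q ℤ.* n) ≡ (p - q) ℤ.* n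
    [r+p*n]-[r+q*n]≡[p-q]*n = ℤ-Solver.solve-∀

    [i+j]-j≡i : ∀ i j → i ℤ.+ j - j ≡ i
    [i+j]-j≡i = ℤ-Solver.solve-∀

    [1+r+q*n]-[1+r]≡q*n : ∀ r q n → + 1 ℤ.+ (r ℤ.+ q ℤ.* n) - (+ 1 ℤ.+ r) ≡ q ℤ.* n
    [1+r+q*n]-[1+r]≡q*n = ℤ-Solver.solve-∀

    remainders : ∀ ra rb qa qb d n → (ra ℤ.+ qa ℤ.* n) - (rb ℤ.+ qb ℤ.* n) ≡ d ℤ.* n →
      ra ≡ rb ℤ.+ (qb ℤ.+ d - qa) ℤ.* n
    remainders ra rb qa qb d n a-b≡d*n = begin
      ra                                                                ≡⟨ split ra rb qa qb n ⟩
      (ra ℤ.+ qa ℤ.* n) - (rb ℤ.+ qb ℤ.* n) ℤ.+ (rb ℤ.+ (qb - qa) ℤ.* n) ≡⟨ cong (ℤ._+ _) a-b≡d*n ⟩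
      d ℤ.* n ℤ.+ (rb ℤ.+ (qb - qa) ℤ.* n)                              ≡⟨ collect rb qa qb d n ⟩
      rb ℤ.+ (qb ℤ.+ d - qa) ℤ.* n                                      ∎
      where
      open ≡-Reasoning
      split : ∀ ra rb qa qb n → ra ≡ (ra ℤ.+ qa ℤ.* n) - (rb ℤ.+ qb ℤ.* n) ℤ.+ (rb ℤ.+ (qb - qa) ℤ.* n)
      split = ℤ-Solver.solve-∀
      collect : ∀ rb qa qb d n → d ℤ.* n ℤ.+ (rb ℤ.+ (qb - qa) ℤ.* n) ≡ rb ℤ.+ (qb ℤ.+ d - qa) ℤ.* n
      collect = ℤ-Solver.solve-∀

    r : ℤ → ℤ
    r z = + (z ℤ.%ℕ m)

    q : ℤ → ℤ
    q z = z ℤ./ℕ m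

    div-mod : ∀ z → z ≡ r z ℤ.+ q z ℤ.* + m
    div-mod z = ℤDivMod.a≡a%ℕn+[a/ℕn]*n z m

  reduce : ℤ → Fin m
  reduce z = fromℕ< (ℤDivMod.n%ℕd<d z m)

  toℕ-reduce : ∀ z → toℕ (reduce z) ≡ z ℤ.%ℕ m
  toℕ-reduce z = Fin.toℕ-fromℕ< _

  residue-unique : ∀ {s s′} e → s < m → s′ < m → + s ≡ + s′ ℤ.+ e ℤ.* + m → s ≡ s′
  residue-unique {s} {s′} (+ e) s<m s′<m eq = begin
    s                ≡⟨ m<n⇒m%n≡m s<m ⟨
    s % m            ≡⟨ cong (_% m) (ℤ.+-injective (trans eq (cong (ℤ._+_ (+ s′)) (sym (ℤ.pos-* e m))))) ⟩
    (s′ + e * m) % m ≡⟨ [m+kn]%n≡m%n s′ e m ⟩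
    s′ % m           ≡⟨ m<n⇒m%n≡m s′<m ⟩
    s′               ∎
    where open ≡-Reasoning
  residue-unique {s} {s′} -[1+ e ] s<m s′<m eq = sym (residue-unique (+ suc e) s′<m s<m eq′)
    where
    eq′ : + s′ ≡ + s ℤ.+ + suc e ℤ.* + m
    eq′ = trans (i≡j+k⇒j≡i-k {k = -[1+ e ] ℤ.* + m} eq) (cong (ℤ._+_ (+ s)) (ℤ.neg-distribˡ-* -[1+ e ] (+ m)))

  reduce-≡⇒∣ : ∀ a b → reduce a ≡ reduce b → + m ∣ a - b
  reduce-≡⇒∣ a b eq = divides (q a - q b) (begin
    a - b                                             ≡⟨ cong₂ _-_ (div-mod a) (div-mod b) ⟩
    (r a ℤ.+ q a ℤ.* + m) - (r b ℤ.+ q b ℤ.* + m)     ≡⟨ cong (λ c → (r a ℤ.+ q a ℤ.* + m) - (c ℤ.+ q b ℤ.* + m)) r≡ ⟨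
    (r a ℤ.+ q a ℤ.* + m) - (r a ℤ.+ q b ℤ.* + m)     ≡⟨ [r+p*n]-[r+q*n]≡[p-q]*n (r a) (q a) (q b) (+ m) ⟩
    (q a - q b) ℤ.* + m                               ∎)
    where
    open ≡-Reasoning
    r≡ : r a ≡ r b
    r≡ = cong +_ (trans (sym (toℕ-reduce a)) (trans (cong toℕ eq) (toℕ-reduce b)))

  ∣⇒reduce-≡ : ∀ a b → + m ∣ a - b → reduce a ≡ reduce b
  ∣⇒reduce-≡ a b (divides d a-b≡d*m) = Fin.toℕ-injective (begin
    toℕ (reduce a) ≡⟨ toℕ-reduce a ⟩
    a ℤ.%ℕ m       ≡⟨ residue-unique (q b ℤ.+ d - q a) (ℤDivMod.n%ℕd<d a m) (ℤDivMod.n%ℕd<d b m) r≡ ⟩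
    b ℤ.%ℕ m       ≡⟨ toℕ-reduce b ⟨
    toℕ (reduce b) ∎)
    where
    open ≡-Reasoning
    r≡ : r a ≡ r b ℤ.+ (q b ℤ.+ d - q a) ℤ.* + m
    r≡ = remainders (r a) (r b) (q a) (q b) d (+ m)
           (trans (sym (cong₂ _-_ (div-mod a) (div-mod b))) a-b≡d*m)

  reduce-+-multiple : ∀ h z → + m ∣ h → reduce (h ℤ.+ z) ≡ reduce z
  reduce-+-multiple h z (divides d h≡d*m) =
    ∣⇒reduce-≡ (h ℤ.+ z) z (divides d (trans ([i+j]-j≡i h z) h≡d*m))

  reduce-suc : ∀ z → reduce (+ 1 ℤ.+ z) ≡ suc (toℕ (reduce z)) mod m
  reduce-suc z = begin
    reduce (+ 1 ℤ.+ z)          ≡⟨ ∣⇒reduce-≡ (+ 1 ℤ.+ z) (+ 1 ℤ.+ r z) (divides (q z) 1+z-[1+r]≡q*m) ⟩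
    reduce (+ suc (z ℤ.%ℕ m))   ≡⟨ cong (λ c → suc c mod m) (toℕ-reduce z) ⟨
    suc (toℕ (reduce z)) mod m  ∎
    where
    open ≡-Reasoning
    1+z-[1+r]≡q*m : + 1 ℤ.+ z - (+ 1 ℤ.+ r z) ≡ q z ℤ.* + m
    1+z-[1+r]≡q*m =
      trans (cong (λ c → + 1 ℤ.+ c - (+ 1 ℤ.+ r z)) (div-mod z)) ([1+r+q*n]-[1+r]≡q*n (r z) (q z) (+ m))

  reduce-toℕ : ∀ i → reduce (+ toℕ i) ≡ i
  reduce-toℕ i = Fin.toℕ-injective (trans (toℕ-reduce (+ toℕ i)) (m<n⇒m%n≡m (Fin.toℕ<n i)))

reduceM : (M : Modulus) → ℤ → ZMod M
reduceM (fin m {{nz}}) = Residues.reduce m {{nz}}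
reduceM ∞              = λ z → z

liftM : (M : Modulus) → ZMod M → ℤ
liftM (fin m) i = + toℕ i
liftM ∞       i = i

reduceM-liftM : ∀ M i → reduceM M (liftM M i) ≡ i
reduceM-liftM (fin m {{nz}}) i = Residues.reduce-toℕ m {{nz}} i
reduceM-liftM ∞              i = refl

reduceM-suc : ∀ M z → reduceM M (+ 1 ℤ.+ z) ≡ sucMod M (reduceM M z)
reduceM-suc (fin m {{nz}}) z = Residues.reduce-suc m {{nz}} z
reduceM-suc ∞              z = refl

reduceM-+-≡0 : ∀ M h z → ≡0mod M h → reduceM M (h ℤ.+ z) ≡ reduceM M z
reduceM-+-≡0 (fin m {{nz}}) h z m∣h  = Residues.reduce-+-multiple m {{nz}} h z (∣ᵤ⇒∣ m∣h)
reduceM-+-≡0 ∞              h z refl = ℤ.+-identityˡ z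

reduceM-≡⇒≡0 : ∀ M a b → reduceM M a ≡ reduceM M b → ≡0mod M (a - b)
reduceM-≡⇒≡0 (fin m {{nz}}) a b eq = ∣⇒∣ᵤ (Residues.reduce-≡⇒∣ m {{nz}} a b eq)
reduceM-≡⇒≡0 ∞              a b eq = ℤ.i≡j⇒i-j≡0 eq

≡0mod-0 : ∀ M → ≡0mod M (+ 0)
≡0mod-0 (fin m) = m ∣0
≡0mod-0 ∞       = refl

module Cosets (k : ℕ) {{_ : NonZero k}} (M : Modulus) (N : ℕ) where
  open Lamplighter k

  0ᴺ : V N
  0ᴺ = 0ᵛ

  _~_ : Word k → Word k → Set
  g ~ g′ = _~[_,_]_ k g N M g′

  ~-refl : ∀ g → g ~ g
  ~-refl g = [] , (refl , ≡0mod-0 M) , =L-refl {g}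

  orbitPoint : Word k → V N
  orbitPoint g = act k (inverse g) 0ᴺ

  orbitPoint-respects : ∀ {g g′} → g ~ g′ → orbitPoint g ≡ orbitPoint g′
  orbitPoint-respects {g} {g′} (h , (h-fixes-0 , _) , g=hg′) = begin
    orbitPoint g                                ≡⟨ cong (act k (inverse g)) g-fixes ⟨
    act k (inverse g) (act k g (orbitPoint g′)) ≡⟨ act-inverse-act g (orbitPoint g′) ⟩
    orbitPoint g′                               ∎
    where
    open ≡-Reasoning
    g-fixes : act k g (orbitPoint g′) ≡ 0ᴺ
    g-fixes = begin
      act k g (orbitPoint g′)              ≡⟨ act-cong g (h ++ g′) g=hg′ (orbitPoint g′) ⟩
      act k (h ++ g′) (orbitPoint g′)      ≡⟨ act-++ h g′ (orbitPoint g′) ⟩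
      act k h (act k g′ (orbitPoint g′))   ≡⟨ cong (act k h) (act-act-inverse g′ 0ᴺ) ⟩
      act k h 0ᴺ                           ≡⟨ h-fixes-0 ⟩
      0ᴺ                                   ∎

  expX-respects : ∀ {g g′} → g ~ g′ → reduceM M (expX k g) ≡ reduceM M (expX k g′)
  expX-respects {g} {g′} (h , (_ , h≡0) , (_ , pos≡)) = begin
    reduceM M (expX k g)                  ≡⟨ cong (reduceM M) (pos-eval g) ⟨
    reduceM M (pos (eval k g))            ≡⟨ cong (reduceM M) pos≡ ⟩
    reduceM M (pos (eval k (h ++ g′)))    ≡⟨ cong (reduceM M) (trans (pos-eval (h ++ g′)) (expX-++ h g′)) ⟩
    reduceM M (expX k h ℤ.+ expX k g′)    ≡⟨ reduceM-+-≡0 M (expX k h) (expX k g′) h≡0 ⟩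
    reduceM M (expX k g′)                 ∎
    where open ≡-Reasoning

  position : Word k → V N × ZMod M
  position g = ψ (orbitPoint g) , reduceM M (expX k g)

  position-respects : ∀ {g g′} → g ~ g′ → position g ≡ position g′
  position-respects {g} {g′} g~g′ =
    cong₂ _,_ (cong ψ (orbitPoint-respects {g} {g′} g~g′)) (expX-respects {g} {g′} g~g′)

  position-reflects : ∀ a b → position a ≡ position b → a ~ b
  position-reflects a b eq = a ++ inverse b , (fixes-0 , expX≡0) , a=[ab⁻¹]b
    where
    fixes-0 : act k (a ++ inverse b) 0ᴺ ≡ 0ᴺ
    fixes-0 = begin
      act k (a ++ inverse b) 0ᴺ  ≡⟨ act-++ a (inverse b) 0ᴺ ⟩
      act k a (orbitPoint b)     ≡⟨ cong (act k a) (ψ-injective (orbitPoint a) (orbitPoint b) (cong proj₁ eq)) ⟨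
      act k a (orbitPoint a)     ≡⟨ act-act-inverse a 0ᴺ ⟩
      0ᴺ                         ∎
      where open ≡-Reasoning
    expX≡0 : ≡0mod M (expX k (a ++ inverse b))
    expX≡0 = subst (≡0mod M) (sym (trans (expX-++ a (inverse b)) (cong (ℤ._+_ (expX k a)) (expX-inverse b))))
                   (reduceM-≡⇒≡0 M (expX k a) (expX k b) (cong proj₂ eq))
    a=[ab⁻¹]b : _=L_ k a ((a ++ inverse b) ++ b)
    a=[ab⁻¹]b = begin
      a                      ≡⟨ List.++-identityʳ a ⟨
      a ++ []                ≈⟨ ++-congˡ a (inverse-++-cancel b) ⟨
      a ++ inverse b ++ b    ≡⟨ List.++-assoc a (inverse b) b ⟨
      (a ++ inverse b) ++ b  ∎
      where open SetoidReasoning =L-setoid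

  representative : V N × ZMod M → Word k
  representative (x , i) = c̄₀^ (liftM M i - + N) ++ path 0ᴺ x

  position-representative : ∀ p → position (representative p) ≡ p
  position-representative (x , i) = cong₂ _,_ coordinates residue
    where
    open ≡-Reasoning
    d = liftM M i - + N
    coordinates : ψ (orbitPoint (c̄₀^ d ++ path 0ᴺ x)) ≡ x
    coordinates = begin
      ψ (act k (inverse (c̄₀^ d ++ path 0ᴺ x)) 0ᴺ)
        ≡⟨ cong (λ w → ψ (act k w 0ᴺ)) (inverse-++ (c̄₀^ d) (path 0ᴺ x)) ⟩
      ψ (act k (inverse (path 0ᴺ x) ++ inverse (c̄₀^ d)) 0ᴺ)
        ≡⟨ cong ψ (act-++ (inverse (path 0ᴺ x)) (inverse (c̄₀^ d)) 0ᴺ) ⟩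
      ψ (act k (inverse (path 0ᴺ x)) (act k (inverse (c̄₀^ d)) 0ᴺ))
        ≡⟨ cong (λ v → ψ (act k (inverse (path 0ᴺ x)) v))
                (act-inverse-fixed (c̄₀^ d) 0ᴺ (trans (act-c̄₀^ d 0ᴺ) (T^-0ᵛ d))) ⟩
      ψ (act k (inverse (path 0ᴺ x)) 0ᴺ)
        ≡⟨ ψ-path 0ᴺ x ⟩
      shiftInAll (ψ 0ᴺ) x
        ≡⟨ shiftInAll-self (ψ 0ᴺ) x ⟩
      x ∎
    residue : reduceM M (expX k (c̄₀^ d ++ path 0ᴺ x)) ≡ i
    residue = begin
      reduceM M (expX k (c̄₀^ d ++ path 0ᴺ x))  ≡⟨ cong (reduceM M) (expX-++ (c̄₀^ d) (path 0ᴺ x)) ⟩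
      reduceM M (expX k (c̄₀^ d) ℤ.+ expX k (path 0ᴺ x)) ≡⟨ cong₂ (λ a b → reduceM M (a ℤ.+ b)) (expX-c̄₀^ d) (expX-path 0ᴺ x) ⟩
      reduceM M (d ℤ.+ + N)                    ≡⟨ cong (reduceM M) (i-j+j≡i (liftM M i) (+ N)) ⟩
      reduceM M (liftM M i)                    ≡⟨ reduceM-liftM M i ⟩
      i ∎

  orbitPoint-representative : ∀ g → orbitPoint (representative (position g)) ≡ orbitPoint g
  orbitPoint-representative g = ψ-injective _ (orbitPoint g) (cong proj₁ (position-representative (position g)))

  swStep : V N × ZMod M → Fin k → V N × ZMod M
  swStep (x , i) y = shiftIn k x y , sucMod M i

  position-step : ∀ g s → position (g ++ (s , true) ∷ []) ≡ swStep (position g) (newLetter (orbitPoint g) s)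
  position-step g s = cong₂ _,_
    (trans (cong (λ w → ψ (act k w 0ᴺ)) (inverse-++ g ((s , true) ∷ [])))
           (trans (cong ψ (act-++ ((s , false) ∷ []) (inverse g) 0ᴺ)) (ψ-c̄⁻¹ (orbitPoint g) s)))
    (trans (cong (reduceM M) (trans (expX-++ g ((s , true) ∷ [])) (ℤ.+-comm (expX k g) (+ 1))))
           (reduceM-suc M (expX k g)))

  representative-position : ∀ g → representative (position g) ~ g
  representative-position g =
    position-reflects (representative (position g)) g (position-representative (position g))

  representative-step : ∀ p y →
    (representative p ++ (letterFor (orbitPoint (representative p)) y , true) ∷ []) ~ representative (swStep p y)
  representative-step p y = position-reflects (representative p ++ (letterFor v y , true) ∷ []) _ (begin
    position (representative p ++ (letterFor v y , true) ∷ [])  ≡⟨ position-step (representative p) (letterFor v y) ⟩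
    swStep (position (representative p)) (newLetter v (letterFor v y))
      ≡⟨ cong₂ swStep (position-representative p) (newLetter-letterFor v y) ⟩
    swStep p y                                                  ≡⟨ position-representative (swStep p y) ⟨
    position (representative (swStep p y))                      ∎)
    where
    open ≡-Reasoning
    v = orbitPoint (representative p)

theorem6p1 : (k : ℕ) {{nz : NonZero k}} → 2 ≤ k → (M : Modulus) (N : ℕ) →
    WeaklyIso (SW k N M) (Schreier k N M)
theorem6p1 k _ M N = record
  { fV       = representative
  ; gV       = position
  ; fV-cong  = λ { refl → ~-refl _ }
  ; gV-cong  = λ {g} {g′} → position-respects {g} {g′}
  ; gfV      = position-representative
  ; fgV      = representative-position
  ; fE       = λ (p , y) → representative p , letterFor (orbitPoint (representative p)) y
  ; gE       = λ (g , s) → position g , newLetter (orbitPoint g) s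
  ; fE-cong  = λ { refl → ~-refl _ , refl }
  ; gE-cong  = λ { {g , s} {g′ , _} (g~g′ , refl) →
                   cong₂ _,_ (position-respects {g} {g′} g~g′)
                             (cong (λ v → newLetter v s) (orbitPoint-respects {g} {g′} g~g′)) }
  ; gfE      = λ (p , y) → cong₂ _,_ (position-representative p) (newLetter-letterFor (orbitPoint (representative p)) y)
  ; fgE      = λ (g , s) → representative-position g ,
                           trans (cong (λ v → letterFor v (newLetter (orbitPoint g) s)) (orbitPoint-representative g))
                                 (letterFor-newLetter (orbitPoint g) s)
  ; src-comm = λ (p , _) → ~-refl (representative p)
  ; tgt-comm = λ (p , y) → representative-step p y
  }
  where
  open Lamplighter k
  open Cosets k M N
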